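{- Let $R$ be a symmetric Boolean relation of arity $k$. If $R$ is not balanced, then $R$ cone-defines the $2$-OR relation.
   Context: $R\subseteq\{0,1\}^k$ is symmetric if there is $S\subseteq\{0,\ldots,k\}$ with $x\in R$ iff the number of ones in $x$ lies in $S$. A partial Boolean operation $f$ of arity $\ell$ is balanced if there are integers $\alpha_1,\ldots,\alpha_\ell$ with $\sum\alpha_i=1$ such that its domain is exactly the tuples with $\sum\alpha_ix_i\in\{0,1\}$, on which $f(x)=\sum\alpha_ix_i$. $f$ preserves $T\subseteq\{0,1\}^m$ if for all $t^1,\ldots,t^\ell\in T$, whenever the coordinatewise application of $f$ is defined in every coordinate, the result lies in $T$; a relation is balanced if preserved by all balanced operations. The $2$-OR relation is $\{(0,1),(1,0),(1,1)\}$. A relation $T$ of arity $m$ is cone-definable from (cone-defined by) a relation $U$ of arity $n$ if there is a tuple $(y_1,\ldots,y_n)$ with each $y_j\in\{0,1\}\cup\{x_1,\ldots,x_m\}\cup\{\neg x_1,\ldots,\neg x_m\}$, every $x_i$ occurs (as $x_i$ or $\neg x_i$) among the $y_j$, and for each $f\colon\{x_1,\ldots,x_m\}\to\{0,1\}$: $(f(x_1),\ldots,f(x_m))\in T$ iff $(\hat f(y_1),\ldots,\hat f(y_n))\in U$, where $\hat f(0)=0$, $\hat f(1)=1$, $\hat f(x_i)=f(x_i)$, $\hat f(\neg x_i)=\neg f(x_i)$. -}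

module Defs where

open import Data.Bool using (Bool; true; false; _∨_; not; if_then_else_)
open import Data.Nat using (ℕ; zero; suc)
open import Data.Integer using (ℤ; +_; _+_; _*_)
import Data.Integer as ℤ
open import Data.Fin using (Fin)
open import Data.Vec using (Vec; []; _∷_; map; lookup; tabulate; count)
open import Data.Vec.Relation.Unary.All using (All)
open import Data.Vec.Relation.Unary.Any using (Any)
open import Data.Product using (Σ; ∃; _×_)
open import Data.Sum using (_⊎_)
open import Data.Empty using (⊥)
open import Relation.Binary.PropositionalEquality using (_≡_)
open import Relation.Nullary.Decidable using (⌊_⌋)

BRel : ℕ → Set
BRel k = Vec Bool k → Bool

_∈R_ : ∀ {k} → Vec Bool k → BRel k → Set
x ∈R R = R x ≡ true

weight : ∀ {k} → Vec Bool k → ℕ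
weight {k} x = count (λ b → b Data.Bool.≟ true) x

-- R symmetric: membership depends only on the number of ones (via a set S ⊆ ℕ;
-- only values 0..k matter)
IsSymmetric : ∀ {k} → BRel k → Set
IsSymmetric {k} R = Σ (ℕ → Bool) λ S → ∀ (x : Vec Bool k) → R x ≡ S (weight x)

bℤ : Bool → ℤ
bℤ true  = + 1
bℤ false = + 0

lin : ∀ {ℓ} → Vec ℤ ℓ → Vec Bool ℓ → ℤ
lin []       []       = + 0
lin (a ∷ as) (b ∷ bs) = a * bℤ b + lin as bs

sumℤ : ∀ {ℓ} → Vec ℤ ℓ → ℤ
sumℤ []       = + 0
sumℤ (a ∷ as) = a + sumℤ as

InDom : ∀ {ℓ} → Vec ℤ ℓ → Vec Bool ℓ → Set
InDom α x = (lin α x ≡ + 0) ⊎ (lin α x ≡ + 1)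

-- value of the balanced operation (meaningful on its domain)
applyBal : ∀ {ℓ} → Vec ℤ ℓ → Vec Bool ℓ → Bool
applyBal α x = ⌊ lin α x ℤ.≟ + 1 ⌋

column : ∀ {ℓ m} → Vec (Vec Bool m) ℓ → Fin m → Vec Bool ℓ
column ts j = map (λ t → lookup t j) ts

Preserves : ∀ {ℓ m} → Vec ℤ ℓ → BRel m → Set
Preserves {ℓ} {m} α T =
  ∀ (ts : Vec (Vec Bool m) ℓ) →
    All (λ t → t ∈R T) ts →
    (∀ (j : Fin m) → InDom α (column ts j)) →
    tabulate (λ j → applyBal α (column ts j)) ∈R T

IsBalanced : ∀ {m} → BRel m → Set
IsBalanced T = ∀ (ℓ : ℕ) (α : Vec ℤ ℓ) → sumℤ α ≡ + 1 → Preserves α T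

OR2 : BRel 2
OR2 (a ∷ b ∷ []) = a ∨ b

data Lit (m : ℕ) : Set where
  const : Bool → Lit m
  pos   : Fin m → Lit m
  neg   : Fin m → Lit m

Mentions : ∀ {m} → Fin m → Lit m → Set
Mentions i (const _) = ⊥
Mentions i (pos j)   = j ≡ i
Mentions i (neg j)   = j ≡ i

evalLit : ∀ {m} → Vec Bool m → Lit m → Bool
evalLit f (const b) = b
evalLit f (pos i)   = lookup f i
evalLit f (neg i)   = not (lookup f i)

ConeDefinable : ∀ {m n} → BRel m → BRel n → Set
ConeDefinable {m} {n} T U =
  Σ (Vec (Lit m) n) λ y →
    (∀ (i : Fin m) → Any (Mentions i) y) ×
    (∀ (f : Vec Bool m) → (T f ≡ true → U (map (evalLit f) y) ≡ true)
                        × (U (map (evalLit f) y) ≡ true → T f ≡ true))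

module Submission where

-- Let R be symmetric of arity k, i.e. R x = S (weight x) for some S : ℕ → Bool.
-- The proof splits on whether S, restricted to [0,k], is closed under the
-- affine operation (x, y, z) ↦ x − y + z.
--
-- * If it is not, some x, y, z ∈ S and t = x − y + z ∉ S lie in [0,k].  Every
--   quadruple with t + y = x + z is the weight profile of a cone built from
--   constants, copies of x₁, ¬x₁, x₂, ¬x₂ (lemma `realize`); padded with 0s to
--   arity k, this cone defines OR2 from R (lemma `cone-from-config`).
-- * If it is, S ∩ [0,k] is empty or an arithmetic progression a + dℤ (lemma
--   `progression`, via the two smallest members of S).  The weight of the image
--   of a balanced operation is the same affine combination of the input weights
--   (lemma `weight-balanced`), and affine combinations of points of a + dℤ stay
--   in a + dℤ (lemma `dot-lattice`); hence R is balanced.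
--
-- Closure is decidable by bounded search, so exactly one case applies.

open import Defs
open import Data.Nat using (ℕ)
open import Relation.Nullary using (¬_)

open import Data.Bool using (Bool; true; false; not; if_then_else_)
import Data.Bool as Bool
open import Data.Nat using (zero; suc; _+_; _*_; _∸_; _≤_; _<_; _≰_; z≤n; s≤s; _<?_)
import Data.Nat.Properties as ℕ
open import Data.Nat.Induction using (<-rec)
open import Data.Nat.Tactic.RingSolver using (solve-∀)
open import Data.Integer using (ℤ; +_; -[1+_])
import Data.Integer as ℤ
import Data.Integer.Properties as ℤₚ
import Data.Integer.Tactic.RingSolver as ℤ-Solver
open import Data.Fin using (Fin) renaming (zero to fzero; suc to fsuc)
open import Data.Vec using (Vec; []; _∷_; _++_; map; lookup; tabulate; replicate; padRight; tail)
open import Data.Vec.Properties using (map-++; map-replicate; tabulate-cong; count≤n)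
open import Data.Vec.Relation.Unary.All using (All; []; _∷_)
import Data.Vec.Relation.Unary.All as All
open import Data.Vec.Relation.Unary.All.Properties using (map⁺)
open import Data.Vec.Relation.Unary.Any using (Any; here; there)
open import Data.Vec.Relation.Unary.Any.Properties using (++⁺ˡ; ++⁺ʳ)
open import Data.Product using (Σ; ∃; _×_; _,_; proj₁; proj₂)
open import Data.Sum using (_⊎_; inj₁; inj₂)
open import Data.Empty using (⊥-elim)
open import Relation.Binary.PropositionalEquality
  using (_≡_; _≢_; refl; sym; trans; cong; cong₂; subst; module ≡-Reasoning)
open import Relation.Nullary using (Dec; yes; no)
open import Relation.Nullary.Decidable using (map′; _×-dec_)

open ≡-Reasoning

false≢true : false ≢ true
false≢true ()

InS : (ℕ → Bool) → ℕ → Set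
InS S x = S x ≡ true

weight≤ : ∀ {m} (x : Vec Bool m) → weight x ≤ m
weight≤ = count≤n (λ b → b Bool.≟ true)

weight-map-++ : ∀ {A : Set} {m n} (g : A → Bool) (xs : Vec A m) (ys : Vec A n) →
                weight (map g (xs ++ ys)) ≡ weight (map g xs) + weight (map g ys)
weight-map-++ g []       ys = refl
weight-map-++ g (x ∷ xs) ys with g x
... | true  = cong suc (weight-map-++ g xs ys)
... | false = weight-map-++ g xs ys

weight-replicate : ∀ n b → weight (replicate n b) ≡ (if b then n else 0)
weight-replicate zero    true  = refl
weight-replicate zero    false = refl
weight-replicate (suc n) true  = cong suc (weight-replicate n true)
weight-replicate (suc n) false = weight-replicate n false

weight-map-replicate : ∀ {A : Set} (g : A → Bool) (a : A) n →
                       weight (map g (replicate n a)) ≡ (if g a then n else 0)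
weight-map-replicate g a n = trans (cong weight (map-replicate g a n)) (weight-replicate n (g a))

weight-padRight : ∀ {A : Set} {m n} (g : A → Bool) {a : A} → g a ≡ false →
                  (m≤n : m ≤ n) (xs : Vec A m) → weight (map g (padRight m≤n a xs)) ≡ weight (map g xs)
weight-padRight g {a} ga (z≤n {n}) [] = trans (weight-map-replicate g a n) (cong (λ b → if b then n else 0) ga)
weight-padRight g ga (s≤s m≤n) (x ∷ xs) with g x
... | true  = cong suc (weight-padRight g ga m≤n xs)
... | false = weight-padRight g ga m≤n xs

any-padRight : ∀ {A : Set} {P : A → Set} {m n} (m≤n : m ≤ n) {a : A} {xs : Vec A m} →
               Any P xs → Any P (padRight m≤n a xs)
any-padRight (s≤s m≤n) (here p)  = here p
any-padRight (s≤s m≤n) (there p) = there (any-padRight m≤n p)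

varX varY : Fin 2
varX = fzero
varY = fsuc fzero

occurrences : ∀ {m} → Fin m → (p q : ℕ) → Vec (Lit m) (p + q)
occurrences i p q = replicate p (pos i) ++ replicate q (neg i)

weight-occurrences : ∀ {m} (f : Vec Bool m) i p q →
                     weight (map (evalLit f) (occurrences i p q)) ≡ (if lookup f i then p else q)
weight-occurrences f i p q = begin
    weight (map (evalLit f) (occurrences i p q))
  ≡⟨ weight-map-++ (evalLit f) (replicate p (pos i)) (replicate q (neg i)) ⟩
    weight (map (evalLit f) (replicate p (pos i))) + weight (map (evalLit f) (replicate q (neg i)))
  ≡⟨ cong₂ _+_ (weight-map-replicate (evalLit f) (pos i) p) (weight-map-replicate (evalLit f) (neg i) q) ⟩
    (if lookup f i then p else 0) + (if not (lookup f i) then q else 0)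
  ≡⟨ select (lookup f i) ⟩
    (if lookup f i then p else q) ∎
  where
  select : ∀ b → (if b then p else 0) + (if not b then q else 0) ≡ (if b then p else q)
  select true  = ℕ.+-identityʳ p
  select false = refl

record Config : Set where
  constructor config
  field
    ones posX negX posY negY : ℕ

size : Config → ℕ
size (config o px nx py ny) = o + ((px + nx) + (py + ny))

literals : (c : Config) → Vec (Lit 2) (size c)
literals (config o px nx py ny) =
  replicate o (const true) ++ (occurrences varX px nx ++ occurrences varY py ny)

weightAt : Config → Bool → Bool → ℕ
weightAt (config o px nx py ny) a b = o + ((if a then px else nx) + (if b then py else ny))

weight-literals : ∀ c a b → weight (map (evalLit (a ∷ b ∷ [])) (literals c)) ≡ weightAt c a b
weight-literals (config o px nx py ny) a b = begin
    weight (map ev (ones ++ (xs ++ ys)))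
  ≡⟨ weight-map-++ ev ones (xs ++ ys) ⟩
    weight (map ev ones) + weight (map ev (xs ++ ys))
  ≡⟨ cong (λ w → weight (map ev ones) + w) (weight-map-++ ev xs ys) ⟩
    weight (map ev ones) + (weight (map ev xs) + weight (map ev ys))
  ≡⟨ cong₂ _+_ (weight-map-replicate ev (const true) o)
               (cong₂ _+_ (weight-occurrences (a ∷ b ∷ []) varX px nx)
                          (weight-occurrences (a ∷ b ∷ []) varY py ny)) ⟩
    weightAt (config o px nx py ny) a b ∎
  where
  ev : Lit 2 → Bool
  ev = evalLit (a ∷ b ∷ [])
  ones : Vec (Lit 2) o
  ones = replicate o (const true)
  xs : Vec (Lit 2) (px + nx)
  xs = occurrences varX px nx
  ys : Vec (Lit 2) (py + ny)
  ys = occurrences varY py ny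

x-occurs : ∀ c → weightAt c true false ≢ weightAt c false false → Any (Mentions varX) (literals c)
x-occurs (config o (suc px) nx py ny) _ =
  ++⁺ʳ (replicate o (const true)) (++⁺ˡ {xs = occurrences varX (suc px) nx} (here refl))
x-occurs (config o zero (suc nx) py ny) _ =
  ++⁺ʳ (replicate o (const true)) (++⁺ˡ {xs = occurrences varX zero (suc nx)} (here refl))
x-occurs (config o zero zero py ny) ≢ = ⊥-elim (≢ refl)

y-occurs : ∀ c → weightAt c false true ≢ weightAt c false false → Any (Mentions varY) (literals c)
y-occurs (config o px nx (suc py) ny) _ =
  ++⁺ʳ (replicate o (const true)) (++⁺ʳ (occurrences varX px nx) (here refl))
y-occurs (config o px nx zero (suc ny)) _ =
  ++⁺ʳ (replicate o (const true)) (++⁺ʳ (occurrences varX px nx) (here refl))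
y-occurs (config o px nx zero zero) ≢ = ⊥-elim (≢ refl)

separated : ∀ {S : ℕ → Bool} {u v} → S u ≡ false → S v ≡ true → v ≢ u
separated Su Sv refl = false≢true (trans (sym Su) Sv)

ORPattern : (ℕ → Bool) → Config → Set
ORPattern S c = S (weightAt c false false) ≡ false × S (weightAt c true false) ≡ true
              × S (weightAt c false true) ≡ true × S (weightAt c true true) ≡ true

cone-from-config : ∀ {k} (R : BRel k) (S : ℕ → Bool) → (∀ x → R x ≡ S (weight x)) →
                   (c : Config) → size c ≤ k → ORPattern S c → ConeDefinable OR2 R
cone-from-config {k} R S R≡S c size≤k (S00 , S10 , S01 , S11) = ys , occurs , defines
  where
  ys : Vec (Lit 2) k
  ys = padRight size≤k (const false) (literals c)

  R-on-cone : ∀ a b → R (map (evalLit (a ∷ b ∷ [])) ys) ≡ S (weightAt c a b)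
  R-on-cone a b = trans (R≡S _) (cong S (trans
    (weight-padRight (evalLit (a ∷ b ∷ [])) refl size≤k (literals c)) (weight-literals c a b)))

  occurs : ∀ i → Any (Mentions i) ys
  occurs fzero        = any-padRight size≤k (x-occurs c (separated {S} S00 S10))
  occurs (fsuc fzero) = any-padRight size≤k (y-occurs c (separated {S} S00 S01))

  defines : ∀ f → (OR2 f ≡ true → R (map (evalLit f) ys) ≡ true)
                × (R (map (evalLit f) ys) ≡ true → OR2 f ≡ true)
  defines (false ∷ false ∷ []) =
    (λ ()) , λ R00 → ⊥-elim (false≢true (trans (sym (trans (R-on-cone false false) S00)) R00))
  defines (true  ∷ false ∷ []) = (λ _ → trans (R-on-cone true false) S10) , λ _ → refl
  defines (false ∷ true  ∷ []) = (λ _ → trans (R-on-cone false true) S01) , λ _ → refl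
  defines (true  ∷ true  ∷ []) = (λ _ → trans (R-on-cone true true) S11) , λ _ → refl

Realizes : Config → ℕ → ℕ → ℕ → ℕ → Set
Realizes c x y z t = weightAt c true false ≡ x × weightAt c true true ≡ y
                   × weightAt c false true ≡ z × weightAt c false false ≡ t

cancel-suc : ∀ x y z t → suc t + suc y ≡ suc x + suc z → t + y ≡ x + z
cancel-suc x y z t eq = ℕ.suc-injective (begin
  suc (t + y)  ≡⟨ sym (ℕ.+-suc t y) ⟩
  t + suc y    ≡⟨ ℕ.suc-injective eq ⟩
  x + suc z    ≡⟨ ℕ.+-suc x z ⟩
  suc (x + z)  ∎)

-- Every quadruple with t + y = x + z in [0,k] is realized by a cone of size ≤ k:
-- strip common constants 1 until one weight is 0, then use only literals.
realize : ∀ {k} x y z t → x ≤ k → y ≤ k → z ≤ k → t ≤ k → t + y ≡ x + z →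
          Σ Config λ c → size c ≤ k × Realizes c x y z t
realize x y z zero _ y≤k _ _ y≡x+z =
  config 0 x 0 z 0 , subst (_≤ _) size≡y y≤k , ℕ.+-identityʳ x , sym y≡x+z , refl , refl
  where
  size≡y : y ≡ (x + 0) + (z + 0)
  size≡y = trans y≡x+z (sym (cong₂ _+_ (ℕ.+-identityʳ x) (ℕ.+-identityʳ z)))
realize x zero z t _ _ _ t≤k eq =
  config 0 0 z 0 x , subst (_≤ _) t≡z+x t≤k , refl , refl , ℕ.+-identityʳ z , sym t≡z+x
  where
  t≡z+x : t ≡ z + x
  t≡z+x = trans (sym (ℕ.+-identityʳ t)) (trans eq (ℕ.+-comm x z))
realize zero y z t _ _ z≤k _ t+y≡z =
  config 0 0 t y 0 , subst (_≤ _) (sym size≡z) z≤k , refl , refl , t+y≡z , ℕ.+-identityʳ t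
  where
  size≡z : t + (y + 0) ≡ z
  size≡z = trans (cong (λ w → t + w) (ℕ.+-identityʳ y)) t+y≡z
realize x y zero t x≤k _ _ _ eq =
  config 0 y 0 0 t , subst (_≤ _) (sym size≡x) x≤k , y+t≡x , ℕ.+-identityʳ y , refl , refl
  where
  y+t≡x : y + t ≡ x
  y+t≡x = trans (ℕ.+-comm y t) (trans eq (ℕ.+-identityʳ x))
  size≡x : (y + 0) + t ≡ x
  size≡x = trans (cong (_+ t) (ℕ.+-identityʳ y)) y+t≡x
realize (suc x) (suc y) (suc z) (suc t) (s≤s x≤k) (s≤s y≤k) (s≤s z≤k) (s≤s t≤k) eq
  with realize x y z t x≤k y≤k z≤k t≤k (cancel-suc x y z t eq)
... | config o px nx py ny , size≤k , w10 , w11 , w01 , w00 =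
  config (suc o) px nx py ny , s≤s size≤k , cong suc w10 , cong suc w11 , cong suc w01 , cong suc w00

AffineClosed : (ℕ → Bool) → ℕ → Set
AffineClosed S k = ∀ {x y z t} → x ≤ k → y ≤ k → z ≤ k → t ≤ k → t + y ≡ x + z →
                   InS S x → InS S y → InS S z → InS S t

∃≤ : ℕ → (ℕ → Set) → Set
∃≤ k P = ∃ λ n → n ≤ k × P n

any≤? : ∀ {P : ℕ → Set} k → (∀ n → Dec (P n)) → Dec (∃≤ k P)
any≤? k P? = map′ (λ (n , n<1+k , p) → n , ℕ.≤-pred n<1+k , p)
                  (λ (n , n≤k , p) → n , s≤s n≤k , p)
                  (ℕ.anyUpTo? P? (suc k))

AffineViolation : (ℕ → Bool) → ℕ → Set
AffineViolation S k = ∃≤ k λ x → ∃≤ k λ y → ∃≤ k λ z → ∃≤ k λ t →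
  t + y ≡ x + z × InS S x × InS S y × InS S z × S t ≡ false

violation? : ∀ S k → Dec (AffineViolation S k)
violation? S k = any≤? k λ x → any≤? k λ y → any≤? k λ z → any≤? k λ t →
  (t + y ℕ.≟ x + z) ×-dec (S x Bool.≟ true) ×-dec (S y Bool.≟ true)
                    ×-dec (S z Bool.≟ true) ×-dec (S t Bool.≟ false)

no-violation-closed : ∀ S k → ¬ AffineViolation S k → AffineClosed S k
no-violation-closed S k ¬violation {x} {y} {z} {t} x≤k y≤k z≤k t≤k eq Sx Sy Sz with S t in St
... | true  = refl
... | false = ⊥-elim (¬violation (x , x≤k , y , y≤k , z , z≤k , t , t≤k , eq , Sx , Sy , Sz , St))

cone-from-violation : ∀ {k} (R : BRel k) (S : ℕ → Bool) → (∀ x → R x ≡ S (weight x)) →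
                      AffineViolation S k → ConeDefinable OR2 R
cone-from-violation R S R≡S (x , x≤k , y , y≤k , z , z≤k , t , t≤k , eq , Sx , Sy , Sz , St)
  with realize x y z t x≤k y≤k z≤k t≤k eq
... | c , size≤k , w10 , w11 , w01 , w00 = cone-from-config R S R≡S c size≤k
  (trans (cong S w00) St , trans (cong S w10) Sx , trans (cong S w01) Sz , trans (cong S w11) Sy)

Least : (ℕ → Set) → ℕ → Set
Least P a = P a × (∀ x → x < a → ¬ P x)

least? : ∀ {P : ℕ → Set} → (∀ n → Dec (P n)) → ∀ n →
         (∃ λ a → a < n × Least P a) ⊎ (∀ x → x < n → ¬ P x)
least? P? zero = inj₂ (λ _ ())
least? {P} P? (suc n) with least? P? n
... | inj₁ (a , a<n , least-a) = inj₁ (a , ℕ.m≤n⇒m≤1+n a<n , least-a)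
... | inj₂ none with P? n
...   | yes Pn = inj₁ (n , ℕ.≤-refl , Pn , none)
...   | no ¬Pn = inj₂ below
  where
  below : ∀ x → x < suc n → ¬ P x
  below x x<1+n with ℕ.m≤n⇒m<n∨m≡n (ℕ.≤-pred x<1+n)
  ... | inj₁ x<n  = none x x<n
  ... | inj₂ refl = ¬Pn

least-member : ∀ {S : ℕ → Bool} {a x} → (∀ y → y < a → ¬ InS S y) →
               ¬ (a < x × InS S x) → InS S x → x ≡ a
least-member below-a not-above Sx =
  ℕ.≤-antisym (ℕ.≮⇒≥ λ a<x → not-above (a<x , Sx)) (ℕ.≮⇒≥ λ x<a → below-a _ x<a Sx)

OnLattice : ℕ → ℕ → ℕ → Set
OnLattice a d x = ∃ λ (j : ℤ) → + x ≡ + a ℤ.+ j ℤ.* + d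

ProgressionOn : (ℕ → Bool) → ℕ → Set
ProgressionOn S k = (∀ x → x ≤ k → ¬ InS S x)
                  ⊎ Σ ℕ λ a → Σ ℕ λ d → ∀ x → x ≤ k → (InS S x → OnLattice a d x) × (OnLattice a d x → InS S x)

pos-progression : ∀ a n d → + (a + n * d) ≡ + a ℤ.+ + n ℤ.* + d
pos-progression a n d = trans (ℤₚ.pos-+ a (n * d)) (cong (λ w → + a ℤ.+ w) (ℤₚ.pos-* n d))

single-member : ∀ S k a → (∀ y → y < a → ¬ InS S y) → InS S a → (∀ x → x < suc k → ¬ (a < x × InS S x)) →
                ∀ x → x ≤ k → (InS S x → OnLattice a 0 x) × (OnLattice a 0 x → InS S x)
single-member S k a below-a Sa none-above x x≤k = to , from
  where
  to : InS S x → OnLattice a 0 x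
  to Sx = + 0 , trans (cong +_ (least-member {S} below-a (none-above x (s≤s x≤k)) Sx))
                      (sym (ℤₚ.+-identityʳ (+ a)))
  from : OnLattice a 0 x → InS S x
  from (j , eq) = subst (InS S) (sym x≡a) Sa
    where
    x≡a : x ≡ a
    x≡a = ℤₚ.+-injective (trans eq (trans (cong (λ w → + a ℤ.+ w) (ℤₚ.*-zeroʳ j)) (ℤₚ.+-identityʳ (+ a))))

-- If a < b are the two smallest members of an affinely closed S, then S is the
-- class a + dℤ on [0,k] with d = b − a.
module TwoSmallest (S : ℕ → Bool) (k : ℕ) (closed : AffineClosed S k)
                   (a b : ℕ) (a≤k : a ≤ k) (b≤k : b ≤ k) (a<b : a < b)
                   (below-a : ∀ x → x < a → ¬ InS S x) (Sa : InS S a)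
                   (gap : ∀ x → x < b → ¬ (a < x × InS S x)) (Sb : InS S b) where

  d : ℕ
  d = b ∸ a

  a+d≡b : a + d ≡ b
  a+d≡b = ℕ.m+[n∸m]≡n (ℕ.<⇒≤ a<b)

  -- Were d ≤ a, the member a − d = a − b + a would lie below a.
  d≰a : d ≰ a
  d≰a d≤a with ℕ.m≤n⇒∃[o]m+o≡n d≤a
  ... | e , d+e≡a = below-a e e<a (closed a≤k b≤k a≤k e≤k e+b≡a+a Sa Sb Sa)
    where
    e<a : e < a
    e<a = subst (e <_) d+e≡a (ℕ.m<n+m e (ℕ.m<n⇒0<n∸m a<b))
    e≤k : e ≤ k
    e≤k = ℕ.≤-trans (ℕ.<⇒≤ e<a) a≤k
    shuffle : ∀ a d e → e + (a + d) ≡ a + (d + e)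
    shuffle = solve-∀
    e+b≡a+a : e + b ≡ a + a
    e+b≡a+a = begin
      e + b        ≡⟨ cong (λ w → e + w) (sym a+d≡b) ⟩
      e + (a + d)  ≡⟨ shuffle a d e ⟩
      a + (d + e)  ≡⟨ cong (λ w → a + w) d+e≡a ⟩
      a + a        ∎

  -- A member b + e ≥ b yields the member a + e = (b + e) − b + a.
  step-down : ∀ e → b + e ≤ k → InS S (b + e) → InS S (a + e)
  step-down e b+e≤k Sb+e = closed b+e≤k b≤k a≤k a+e≤k (swap a b e) Sb+e Sb Sa
    where
    a+e≤k : a + e ≤ k
    a+e≤k = ℕ.≤-trans (ℕ.+-monoˡ-≤ e (ℕ.<⇒≤ a<b)) b+e≤k
    swap : ∀ a b e → (a + e) + b ≡ (b + e) + a
    swap = solve-∀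

  OnProgression : ℕ → Set
  OnProgression x = ∃ λ n → x ≡ a + n * d

  members-on-progression : ∀ x → x ≤ k → InS S x → OnProgression x
  members-on-progression = <-rec (λ x → x ≤ k → InS S x → OnProgression x) step
    where
    step : ∀ x → (∀ {y} → y < x → y ≤ k → InS S y → OnProgression y) →
           x ≤ k → InS S x → OnProgression x
    step x rec x≤k Sx with x <? b
    ... | yes x<b = 0 , trans (least-member {S} below-a (gap x x<b) Sx) (sym (ℕ.+-identityʳ a))
    ... | no x≮b with ℕ.m≤n⇒∃[o]m+o≡n (ℕ.≮⇒≥ x≮b)
    ...   | e , refl with rec a+e<b+e (ℕ.≤-trans (ℕ.<⇒≤ a+e<b+e) x≤k) (step-down e x≤k Sx)
      where
      a+e<b+e : a + e < b + e
      a+e<b+e = ℕ.+-monoˡ-< e a<b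
    ...     | n , a+e≡a+nd = suc n , (begin
      b + e          ≡⟨ cong₂ _+_ (sym a+d≡b) (ℕ.+-cancelˡ-≡ a e (n * d) a+e≡a+nd) ⟩
      a + d + n * d  ≡⟨ ℕ.+-assoc a d (n * d) ⟩
      a + suc n * d  ∎)

  -- Conversely every a + n·d in [0,k] is a member: it is (a + (n−1)d) − a + b.
  progression-members : ∀ n → a + n * d ≤ k → InS S (a + n * d)
  progression-members zero    _  = subst (InS S) (sym (ℕ.+-identityʳ a)) Sa
  progression-members (suc n) le =
    closed prev≤k a≤k b≤k le eq (progression-members n prev≤k) Sa Sb
    where
    prev≤k : a + n * d ≤ k
    prev≤k = ℕ.≤-trans (ℕ.+-monoʳ-≤ a (ℕ.m≤n+m (n * d) d)) le
    rearrange : ∀ a d m → (a + (d + m)) + a ≡ (a + m) + (a + d)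
    rearrange = solve-∀
    eq : a + suc n * d + a ≡ a + n * d + b
    eq = trans (rearrange a d (n * d)) (cong (λ w → a + n * d + w) a+d≡b)

  lattice : ∀ x → x ≤ k → (InS S x → OnLattice a d x) × (OnLattice a d x → InS S x)
  lattice x x≤k = to , from
    where
    to : InS S x → OnLattice a d x
    to Sx with members-on-progression x x≤k Sx
    ... | n , x≡a+nd = + n , trans (cong +_ x≡a+nd) (pos-progression a n d)
    cancel : ∀ (A M D : ℤ) → A ℤ.+ (ℤ.- M) ℤ.* D ℤ.+ M ℤ.* D ≡ A
    cancel = ℤ-Solver.solve-∀
    from : OnLattice a d x → InS S x
    from (+ n , eq) = subst (InS S) (sym x≡a+nd) (progression-members n (subst (_≤ k) x≡a+nd x≤k))
      where
      x≡a+nd : x ≡ a + n * d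
      x≡a+nd = ℤₚ.+-injective (trans eq (sym (pos-progression a n d)))
    -- A negative multiple would give a = x + (n+1)d ≥ d.
    from (-[1+ n ] , eq) = ⊥-elim (d≰a (subst (d ≤_) below≡a d≤below))
      where
      below≡a : x + suc n * d ≡ a
      below≡a = ℤₚ.+-injective (begin
        + (x + suc n * d)                                ≡⟨ pos-progression x (suc n) d ⟩
        + x ℤ.+ + suc n ℤ.* + d                          ≡⟨ cong (ℤ._+ + suc n ℤ.* + d) eq ⟩
        + a ℤ.+ -[1+ n ] ℤ.* + d ℤ.+ + suc n ℤ.* + d     ≡⟨ cancel (+ a) (+ suc n) (+ d) ⟩
        + a                                              ∎)
      d≤below : d ≤ x + suc n * d
      d≤below = ℕ.≤-trans (ℕ.m≤m+n d (n * d)) (ℕ.m≤n+m (suc n * d) x)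

progression : ∀ S k → AffineClosed S k → ProgressionOn S k
progression S k closed with least? (λ x → S x Bool.≟ true) (suc k)
... | inj₂ none = inj₁ (λ x x≤k → none x (s≤s x≤k))
... | inj₁ (a , a<1+k , Sa , below-a) with least? (λ x → (a <? x) ×-dec (S x Bool.≟ true)) (suc k)
...   | inj₂ none-above = inj₂ (a , 0 , single-member S k a below-a Sa none-above)
...   | inj₁ (b , b<1+k , (a<b , Sb) , gap) =
  inj₂ (a , b ∸ a , TwoSmallest.lattice S k closed a b (ℕ.≤-pred a<1+k) (ℕ.≤-pred b<1+k) a<b below-a Sa gap Sb)

dot : ∀ {ℓ} → Vec ℤ ℓ → Vec ℤ ℓ → ℤ
dot []       []       = + 0
dot (α ∷ αs) (v ∷ vs) = α ℤ.* v ℤ.+ dot αs vs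

weightℤ : ∀ {m} → Vec Bool m → ℤ
weightℤ t = + weight t

weightℤ-∷ : ∀ {m} b (t : Vec Bool m) → weightℤ (b ∷ t) ≡ bℤ b ℤ.+ weightℤ t
weightℤ-∷ true  t = refl
weightℤ-∷ false t = refl

applyBal-value : ∀ {ℓ} (α : Vec ℤ ℓ) x → InDom α x → bℤ (applyBal α x) ≡ lin α x
applyBal-value α x (inj₁ e) rewrite e = refl
applyBal-value α x (inj₂ e) rewrite e = refl

column-suc : ∀ {ℓ m} (ts : Vec (Vec Bool (suc m)) ℓ) j → column ts (fsuc j) ≡ column (map tail ts) j
column-suc []             j = refl
column-suc ((b ∷ t) ∷ ts) j = cong (lookup t j ∷_) (column-suc ts j)

dot-weights-∷ : ∀ {ℓ m} (α : Vec ℤ ℓ) (ts : Vec (Vec Bool (suc m)) ℓ) →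
                dot α (map weightℤ ts) ≡ lin α (column ts fzero) ℤ.+ dot α (map weightℤ (map tail ts))
dot-weights-∷ []       []             = refl
dot-weights-∷ (α ∷ αs) ((b ∷ t) ∷ ts) = begin
    α ℤ.* weightℤ (b ∷ t) ℤ.+ dot αs (map weightℤ ts)
  ≡⟨ cong₂ (λ u v → α ℤ.* u ℤ.+ v) (weightℤ-∷ b t) (dot-weights-∷ αs ts) ⟩
    α ℤ.* (bℤ b ℤ.+ weightℤ t) ℤ.+ (lin αs (column ts fzero) ℤ.+ dot αs (map weightℤ (map tail ts)))
  ≡⟨ regroup α (bℤ b) (weightℤ t) (lin αs (column ts fzero)) (dot αs (map weightℤ (map tail ts))) ⟩
    (α ℤ.* bℤ b ℤ.+ lin αs (column ts fzero)) ℤ.+ (α ℤ.* weightℤ t ℤ.+ dot αs (map weightℤ (map tail ts))) ∎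
  where
  regroup : ∀ (c x y u v : ℤ) → c ℤ.* (x ℤ.+ y) ℤ.+ (u ℤ.+ v) ≡ (c ℤ.* x ℤ.+ u) ℤ.+ (c ℤ.* y ℤ.+ v)
  regroup = ℤ-Solver.solve-∀

dot-weights-[] : ∀ {ℓ} (α : Vec ℤ ℓ) (ts : Vec (Vec Bool 0) ℓ) → dot α (map weightℤ ts) ≡ + 0
dot-weights-[] []       []        = refl
dot-weights-[] (α ∷ αs) ([] ∷ ts) =
  trans (cong (λ w → α ℤ.* + 0 ℤ.+ w) (dot-weights-[] αs ts)) (trans (ℤₚ.+-identityʳ _) (ℤₚ.*-zeroʳ α))

weight-balanced : ∀ {ℓ} m (α : Vec ℤ ℓ) (ts : Vec (Vec Bool m) ℓ) → (∀ j → InDom α (column ts j)) →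
                  weightℤ (tabulate (λ j → applyBal α (column ts j))) ≡ dot α (map weightℤ ts)
weight-balanced zero    α ts dom = sym (dot-weights-[] α ts)
weight-balanced (suc m) α ts dom = begin
    weightℤ (applyBal α (column ts fzero) ∷ tabulate (λ j → applyBal α (column ts (fsuc j))))
  ≡⟨ weightℤ-∷ (applyBal α (column ts fzero)) (tabulate (λ j → applyBal α (column ts (fsuc j)))) ⟩
    bℤ (applyBal α (column ts fzero)) ℤ.+ weightℤ (tabulate (λ j → applyBal α (column ts (fsuc j))))
  ≡⟨ cong₂ ℤ._+_ (applyBal-value α _ (dom fzero)) (trans
       (cong weightℤ (tabulate-cong (λ j → cong (applyBal α) (column-suc ts j))))
       (weight-balanced m α (map tail ts) (λ j → subst (InDom α) (column-suc ts j) (dom (fsuc j))))) ⟩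
    lin α (column ts fzero) ℤ.+ dot α (map weightℤ (map tail ts))
  ≡⟨ sym (dot-weights-∷ α ts) ⟩
    dot α (map weightℤ ts) ∎

dot-lattice : ∀ {ℓ} (A D : ℤ) (α vs : Vec ℤ ℓ) → All (λ v → ∃ λ j → v ≡ A ℤ.+ j ℤ.* D) vs →
              ∃ λ J → dot α vs ≡ A ℤ.* sumℤ α ℤ.+ J ℤ.* D
dot-lattice A D [] [] [] = + 0 , sym (cong₂ ℤ._+_ (ℤₚ.*-zeroʳ A) (ℤₚ.*-zeroˡ D))
dot-lattice A D (α ∷ αs) (v ∷ vs) ((j , v≡) ∷ rest) with dot-lattice A D αs vs rest
... | J , eq = α ℤ.* j ℤ.+ J , (begin
    α ℤ.* v ℤ.+ dot αs vs
  ≡⟨ cong₂ (λ u w → α ℤ.* u ℤ.+ w) v≡ eq ⟩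
    α ℤ.* (A ℤ.+ j ℤ.* D) ℤ.+ (A ℤ.* sumℤ αs ℤ.+ J ℤ.* D)
  ≡⟨ regroup α A j D J (sumℤ αs) ⟩
    A ℤ.* (α ℤ.+ sumℤ αs) ℤ.+ (α ℤ.* j ℤ.+ J) ℤ.* D ∎)
  where
  regroup : ∀ (c A j D J s : ℤ) → c ℤ.* (A ℤ.+ j ℤ.* D) ℤ.+ (A ℤ.* s ℤ.+ J ℤ.* D)
                                   ≡ A ℤ.* (c ℤ.+ s) ℤ.+ (c ℤ.* j ℤ.+ J) ℤ.* D
  regroup = ℤ-Solver.solve-∀

progression-balanced : ∀ {k} (R : BRel k) (S : ℕ → Bool) → (∀ x → R x ≡ S (weight x)) →
                       ProgressionOn S k → IsBalanced R
progression-balanced R S R≡S (inj₁ empty) _ []      ()  _        _               _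
progression-balanced R S R≡S (inj₁ empty) _ (_ ∷ _) _  (t ∷ _) (t∈R ∷ _) _ =
  ⊥-elim (empty (weight t) (weight≤ t) (trans (sym (R≡S t)) t∈R))
progression-balanced {k} R S R≡S (inj₂ (a , d , lattice)) _ α sum≡1 ts members dom =
  trans (R≡S result) (proj₂ (lattice (weight result) (weight≤ result)) (J , weight≡))
  where
  result : Vec Bool k
  result = tabulate (λ j → applyBal α (column ts j))

  on-lattice : ∀ {t} → t ∈R R → ∃ λ j → weightℤ t ≡ + a ℤ.+ j ℤ.* + d
  on-lattice {t} t∈R = proj₁ (lattice (weight t) (weight≤ t)) (trans (sym (R≡S t)) t∈R)

  combination : ∃ λ J → dot α (map weightℤ ts) ≡ + a ℤ.* sumℤ α ℤ.+ J ℤ.* + d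
  combination = dot-lattice (+ a) (+ d) α (map weightℤ ts) (map⁺ (All.map on-lattice members))
  J : ℤ
  J = proj₁ combination

  weight≡ : + weight result ≡ + a ℤ.+ J ℤ.* + d
  weight≡ = begin
    + weight result                       ≡⟨ weight-balanced k α ts dom ⟩
    dot α (map weightℤ ts)                ≡⟨ proj₂ combination ⟩
    + a ℤ.* sumℤ α ℤ.+ J ℤ.* + d          ≡⟨ cong (λ s → + a ℤ.* s ℤ.+ J ℤ.* + d) sum≡1 ⟩
    + a ℤ.* + 1 ℤ.+ J ℤ.* + d             ≡⟨ cong (ℤ._+ J ℤ.* + d) (ℤₚ.*-identityʳ (+ a)) ⟩
    + a ℤ.+ J ℤ.* + d                     ∎

lemma5p4 : ∀ (k : ℕ) (R : BRel k) → IsSymmetric R → ¬ IsBalanced R → ConeDefinable OR2 R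
lemma5p4 k R (S , R≡S) not-balanced with violation? S k
... | yes violation  = cone-from-violation R S R≡S violation
... | no ¬violation = ⊥-elim (not-balanced
  (progression-balanced R S R≡S (progression S k (no-violation-closed S k ¬violation))))
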